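{- Let $C$ be an $(X,2)$-neighbour-transitive code in $H(m,q)$ with minimum distance $\delta\geq 5$ and $\mathbf{0}\in C$, and let $i,j\in M$ be distinct. Then: (1) the stabiliser $X_{\mathbf{0},i,j}$ acts transitively on each of $Q_i^\times$ and $Q_j^\times$; (2) $X_{\mathbf{0},i,j}$ has at most two orbits on $Q_i^\times\times Q_j^\times$, and if it has two orbits then both have the same size and $X_{\mathbf{0}}$ acts $2$-transitively on $M$; (3) $\binom{m}{2}(q-1)^2$ divides $|X_{\mathbf{0}}|$, and hence divides $|X|$; (4) if $|X_{\mathbf{0}}|=\binom{m}{2}$ then $q=2$.
   Context: The Hamming graph $H(m,q)$ has vertex set $\prod_{i\in M}Q_i$ with $|M|=m$ and each $Q_i$ a copy of an alphabet $Q$ of size $q$ containing a distinguished element $0$; vertices are adjacent iff they differ in exactly one entry. $\mathbf{0}$ is the vertex with $0$ in every entry and $Q_i^\times=Q_i\setminus\{0\}$. A code is a set $C$ of vertices with minimum distance $\delta$; $C_s$ is the set of vertices at distance exactly $s$ from $C$. $\mathrm{Aut}(H(m,q))=B\rtimes L$, $B\cong\mathrm{Sym}(Q)^m$ acting coordinatewise, $L\cong\mathrm{Sym}(M)$ permuting entries; $\mathrm{Aut}(C)$ is the setwise stabiliser of $C$. For $X\leq\mathrm{Aut}(C)$, $C$ is $(X,2)$-neighbour-transitive if $X$ is transitive on each of $C$, $C_1$, $C_2$. $X_{\mathbf{0}}$ is the stabiliser of the vertex $\mathbf{0}$, and $X_{\mathbf{0},i,j}$ the subgroup of $X_{\mathbf{0}}$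 fixing the entries $i$ and $j$ (so it acts on $Q_i$ and $Q_j$); $X_{\mathbf{0}}$ acts on $M$ via the projection to $L$. -}

module Defs where

open import Data.Nat using (ℕ; zero; suc; _≤_)
open import Data.Fin using (Fin; zero; suc; _≟_)
open import Data.Vec using (Vec; lookup; tabulate; replicate)
import Data.Vec.Properties as VecP
open import Data.List using (List; filter; length; allFin; cartesianProduct)
open import Data.List.Membership.Propositional using (_∈_)
open import Data.List.Relation.Unary.Any using (any?)
open import Data.List.Relation.Unary.Unique.Propositional using (Unique)
open import Data.Product using (Σ; ∃; _×_; _,_; proj₁; proj₂)
import Data.Product.Properties as ProdP
open import Data.Bool using (Bool; true)
open import Function using (id)
open import Function.Definitions using (Injective)
open import Relation.Binary.PropositionalEquality using (_≡_; _≢_)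
open import Relation.Nullary using (¬_; ¬?; Dec)
open import Relation.Nullary.Decidable using (_×-dec_)

-- The Hamming graph H(m,q): entries M = Fin m, alphabet Q = Fin q,
-- distinguished letter 0 = Fin.zero (so q = suc p below).

Vertex : ℕ → ℕ → Set
Vertex m q = Vec (Fin q) m

_≟v_ : ∀ {m q} (u v : Vertex m q) → Dec (u ≡ v)
_≟v_ = VecP.≡-dec _≟_

zeroV : ∀ m p → Vertex m (suc p)
zeroV m p = replicate m zero

dist : ∀ {m q} → Vertex m q → Vertex m q → ℕ
dist {m} u v = length (filter (λ k → ¬? (lookup u k ≟ lookup v k)) (allFin m))

-- Elements of B ⋊ L = Sym(Q) wr Sym(M), stored as lookup tables
-- (canonical, so distinct tables are distinct maps).
-- g = (σ , h) acts on vertices by  (g · v)_k = h_k (v_{σ k}),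
-- i.e. the entry σ k of v is moved to position k (g acts on M as σ⁻¹)
-- and the letter there is changed by h_k.

Elt : ℕ → ℕ → Set
Elt m q = Vec (Fin m) m × Vec (Vec (Fin q) q) m

perm : ∀ {m q} → Elt m q → Fin m → Fin m
perm g = lookup (proj₁ g)

letter : ∀ {m q} → Elt m q → Fin m → Fin q → Fin q
letter g k = lookup (lookup (proj₂ g) k)

act : ∀ {m q} → Elt m q → Vertex m q → Vertex m q
act g v = tabulate (λ k → letter g k (lookup v (perm g k)))

IsAutH : ∀ {m q} → Elt m q → Set
IsAutH g = Injective _≡_ _≡_ (perm g) × (∀ k → Injective _≡_ _≡_ (letter g k))

idE : ∀ {m q} → Elt m q
idE {m} {q} = tabulate id , replicate m (tabulate id)

-- compose g₁ g₂ acts as v ↦ g₁ · (g₂ · v)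
compose : ∀ {m q} → Elt m q → Elt m q → Elt m q
compose g₁ g₂ =
  tabulate (λ k → perm g₂ (perm g₁ k)) ,
  tabulate (λ k → tabulate (λ a → letter g₁ k (letter g₂ (perm g₁ k) a)))

-- A subgroup X ≤ Aut(H(m,q)), given as the (duplicate-free) list of its
-- elements; a finite nonempty subset closed under composition is a subgroup.
record IsSubgroup {m q} (X : List (Elt m q)) : Set where
  field
    unique : Unique X
    auts   : ∀ g → g ∈ X → IsAutH g
    idIn   : idE ∈ X
    closed : ∀ g₁ g₂ → g₁ ∈ X → g₂ ∈ X → compose g₁ g₂ ∈ X

Code : ℕ → ℕ → Set
Code m q = Vertex m q → Bool

_≤AutC_ : ∀ {m q} → List (Elt m q) → Code m q → Set
X ≤AutC C = ∀ g → g ∈ X → ∀ v → C (act g v) ≡ C v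

MinDist : ∀ {m q} → Code m q → ℕ → Set
MinDist C δ =
  (Σ _ λ c → Σ _ λ c′ → C c ≡ true × C c′ ≡ true × c ≢ c′ × dist c c′ ≡ δ)
  × (∀ c c′ → C c ≡ true → C c′ ≡ true → c ≢ c′ → δ ≤ dist c c′)

InCs : ∀ {m q} → Code m q → ℕ → Vertex m q → Set
InCs C s v = (∃ λ c → C c ≡ true × dist v c ≡ s)
           × (∀ c → C c ≡ true → s ≤ dist v c)

TransitiveOn : ∀ {m q} → List (Elt m q) → (Vertex m q → Set) → Set
TransitiveOn X S = ∀ u v → S u → S v → ∃ λ g → g ∈ X × act g u ≡ v

TwoNT : ∀ {m q} → List (Elt m q) → Code m q → Set
TwoNT X C = TransitiveOn X (λ v → C v ≡ true)
          × TransitiveOn X (InCs C 1)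
          × TransitiveOn X (InCs C 2)

stab0 : ∀ {m p} → List (Elt m (suc p)) → List (Elt m (suc p))
stab0 {m} {p} X = filter (λ g → act g (zeroV m p) ≟v zeroV m p) X

stab0ij : ∀ {m p} → List (Elt m (suc p)) → Fin m → Fin m → List (Elt m (suc p))
stab0ij X i j = filter (λ g → (perm g i ≟ i) ×-dec (perm g j ≟ j)) (stab0 X)

TransOnQ× : ∀ {m p} → List (Elt m (suc p)) → Fin m → Set
TransOnQ× Y i = ∀ a b → a ≢ zero → b ≢ zero → ∃ λ g → g ∈ Y × letter g i a ≡ b

imgPair : ∀ {m q} → Elt m q → Fin m → Fin m → Fin q × Fin q → Fin q × Fin q
imgPair g i j (a , b) = letter g i a , letter g j b

InOrbit : ∀ {m q} → List (Elt m q) → Fin m → Fin m → (x y : Fin q × Fin q) → Set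
InOrbit Y i j x y = ∃ λ g → g ∈ Y × imgPair g i j x ≡ y

NonzeroPair : ∀ {p} → Fin (suc p) × Fin (suc p) → Set
NonzeroPair (a , b) = a ≢ zero × b ≢ zero

orbitSize : ∀ {m q} → List (Elt m q) → Fin m → Fin m → Fin q × Fin q → ℕ
orbitSize {m} {q} Y i j x =
  length (filter (λ y → any? (λ g → ProdP.≡-dec _≟_ _≟_ (imgPair g i j x) y) Y)
                 (cartesianProduct (allFin q) (allFin q)))

AtMostTwoOrbits : ∀ {m p} → List (Elt m (suc p)) → Fin m → Fin m → Set
AtMostTwoOrbits Y i j =
  Σ _ λ x₁ → Σ _ λ x₂ → NonzeroPair x₁ × NonzeroPair x₂ ×
    (∀ y → NonzeroPair y → InOrbit Y i j x₁ y ⊎′ InOrbit Y i j x₂ y)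
  where
  open import Data.Sum using () renaming (_⊎_ to _⊎′_)

-- g maps entry k to entry k′ (g acts on M as σ⁻¹)
mapsEntry : ∀ {m q} → Elt m q → Fin m → Fin m → Set
mapsEntry g k k′ = perm g k′ ≡ k

TwoTransitiveOnM : ∀ {m q} → List (Elt m q) → Set
TwoTransitiveOnM Y = ∀ i₁ j₁ i₂ j₂ → i₁ ≢ j₁ → i₂ ≢ j₂ →
  ∃ λ g → g ∈ Y × mapsEntry g i₁ i₂ × mapsEntry g j₁ j₂

module Submission where

-- Everything rests on one observation: as δ ≥ 5, every weight-two vertex
-- lies in C₂, and an element of X carrying one weight-two vertex to another
-- moves the codeword 0 by at most 4, so it fixes 0.  Hence X₀ is transitive
-- on weight-two vertices, and an element of X₀ carrying letters a, b in
-- entries k, l to letters a′, b′ in entries k′, l′ maps {k, l} onto {k′, l′},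
-- in order or exchanged.  Then (1): such elements keeping the order, or the
-- squares of those exchanging i and j, make X_{0,i,j} transitive on Q_i^×
-- and Q_j^×; (2): the X_{0,i,j}-orbits are that of (1,1) and, if some
-- element of X₀ exchanges i and j, one more; conjugation by such an element
-- matches the two orbit sizes and makes X₀ 2-transitive on M; (3): orbit–
-- stabiliser for X₀ on the (m choose 2)(q−1)² weight-two vertices, and
-- Lagrange for X₀ ≤ X; (4) follows from (3).

open import Defs
open import Data.Nat using (ℕ; suc; _≤_; _*_; _^_; _∸_)
open import Data.Nat.Divisibility using (_∣_)
open import Data.Nat.Combinatorics using (_C_)
open import Data.Fin using (Fin)
open import Data.List using (List; length)
open import Data.Product using (_×_)
open import Data.Bool using (true)
open import Relation.Binary.PropositionalEquality using (_≡_; _≢_)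
open import Relation.Nullary using (¬_)

open import Data.Nat using (zero; _+_; _<_; z≤n; s≤s; pred; >-nonZero)
open import Data.Nat.Properties
  using (≤-trans; ≤-antisym; ≤-reflexive; n≤1+n; <-irrefl; +-suc;
         +-mono-≤; +-cancelˡ-≤; *-comm; *-identityʳ; m*n≡1⇒m≡1)
open import Data.Nat.Divisibility using (divides; ∣-trans; ∣1⇒≡1; *-cancelˡ-∣)
open import Data.Nat.Combinatorics using (nCk+nC[k+1]≡[n+1]C[k+1]; nC1≡n)
open import Data.Nat.Tactic.RingSolver using (solve-∀)
open import Data.Fin using (zero; suc; _≟_)
open import Data.Fin.Properties using (suc-injective)
open import Data.Vec using (Vec; []; _∷_; lookup; tabulate; replicate)
open import Data.Vec.Properties
  using (lookup∘tabulate; tabulate∘lookup; tabulate-cong; lookup-replicate; ∷-injectiveˡ; ∷-injectiveʳ)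
  renaming (≡-dec to ≡-dec-vec)
import Data.List as List
open import Data.List
  using ([]; _∷_; _++_; filter; map; allFin; deduplicate; cartesianProductWith; cartesianProduct)
open import Data.List.Properties using (length-++; length-map; length-tabulate)
open import Data.List.Membership.Propositional using (_∈_; find; lose)
open import Data.List.Membership.Propositional.Properties
  using (∈-filter⁺; ∈-filter⁻; ∈-allFin; ∈-map⁺; ∈-map⁻; ∈-deduplicate⁺; ∈-deduplicate⁻;
         ∈-++⁺ˡ; ∈-++⁺ʳ; ∈-++⁻; ∈-cartesianProduct⁺;
         ∈-cartesianProductWith⁺; ∈-cartesianProductWith⁻)
open import Data.List.Relation.Unary.Any using (Any; here; there; any?)
import Data.List.Relation.Unary.All as All
open import Data.List.Relation.Unary.All using ([]; _∷_)
open import Data.List.Relation.Unary.AllPairs using ([]; _∷_)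
open import Data.List.Relation.Unary.Unique.Propositional using (Unique)
open import Data.List.Relation.Unary.Unique.Propositional.Properties
  using (filter⁺; allFin⁺; ++⁺; map⁺; cartesianProductWith⁺; cartesianProduct⁺)
open import Data.List.Relation.Unary.Unique.DecPropositional.Properties using (deduplicate-!)
open import Data.Product using (∃; _,_; proj₁; proj₂)
open import Data.Product.Properties using () renaming (≡-dec to ≡-dec-×)
open import Data.Sum using (_⊎_; inj₁; inj₂)
open import Data.Empty using (⊥-elim)
open import Function using (id; _∘_; case_of_)
open import Function.Definitions using (Injective)
open import Level using (0ℓ)
open import Relation.Binary.PropositionalEquality
  using (refl; sym; trans; cong; cong₂; subst; subst₂; module ≡-Reasoning)
open import Relation.Binary.Definitions using (DecidableEquality)
open import Relation.Nullary using (Dec; yes; no; ¬?)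
open import Relation.Nullary.Decidable using (_×-dec_)
open import Relation.Unary using (Pred; Decidable)

-- Counting on finite lists.  A list without duplicates stands for a finite
-- set; these are the pigeonhole and fibre-counting facts used below.
module Counting where

  private variable A B : Set

  remove : ∀ {x : A} {xs} → x ∈ xs → List A
  remove {xs = _ ∷ xs} (here _)  = xs
  remove {xs = y ∷ _}  (there p) = y ∷ remove p

  length-remove : ∀ {x} {xs : List A} (p : x ∈ xs) → length xs ≡ suc (length (remove p))
  length-remove (here _)  = refl
  length-remove (there p) = cong suc (length-remove p)

  ∈-remove : ∀ {x y} {xs : List A} (p : x ∈ xs) → y ∈ xs → y ≢ x → y ∈ remove p
  ∈-remove (here refl) (here refl) y≢x = ⊥-elim (y≢x refl)
  ∈-remove (here refl) (there q)   _   = q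
  ∈-remove (there p)   (here e)    _   = here e
  ∈-remove (there p)   (there q)   y≢x = there (∈-remove p q y≢x)

  injection⇒length≤ : ∀ {xs : List A} {ys : List B} (f : A → B) → Unique xs →
    (∀ {x y} → x ∈ xs → y ∈ xs → f x ≡ f y → x ≡ y) →
    (∀ {x} → x ∈ xs → f x ∈ ys) → length xs ≤ length ys
  injection⇒length≤ {xs = []} f _ _ _ = z≤n
  injection⇒length≤ {xs = x ∷ xs} {ys} f (x∉xs ∷ uxs) inj into =
    subst (suc (length xs) ≤_) (sym (length-remove fx∈ys))
      (s≤s (injection⇒length≤ f uxs (λ p q → inj (there p) (there q)) into′))
    where
    fx∈ys = into (here refl)
    into′ : ∀ {z} → z ∈ xs → f z ∈ remove fx∈ys
    into′ z∈xs = ∈-remove fx∈ys (into (there z∈xs))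
      (λ e → All.lookup x∉xs z∈xs (sym (inj (there z∈xs) (here refl) e)))

  injective⇒surjective : DecidableEquality A → ∀ {xs : List A} (f : A → A) → Unique xs →
    (∀ {x y} → x ∈ xs → y ∈ xs → f x ≡ f y → x ≡ y) →
    (∀ {x} → x ∈ xs → f x ∈ xs) → ∀ {y} → y ∈ xs → ∃ λ x → x ∈ xs × f x ≡ y
  injective⇒surjective _≟ₐ_ {xs} f uxs inj into {y} y∈xs with any? (λ x → f x ≟ₐ y) xs
  ... | yes hit = witness hit
    where
    witness : ∀ {zs} → Any (λ x → f x ≡ y) zs → ∃ λ x → x ∈ zs × f x ≡ y
    witness (here e)  = _ , here refl , e
    witness (there r) = let (x , x∈ , e) = witness r in x , there x∈ , e
  ... | no miss = ⊥-elim (<-irrefl refl (subst (_≤ length (remove y∈xs)) (length-remove y∈xs) xs≤))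
    where
    xs≤ : length xs ≤ length (remove y∈xs)
    xs≤ = injection⇒length≤ f uxs inj (λ x∈xs → ∈-remove y∈xs (into x∈xs) (λ e → miss (toAny x∈xs e)))
      where
      toAny : ∀ {x zs} → x ∈ zs → f x ≡ y → Any (λ z → f z ≡ y) zs
      toAny (here refl) e = here e
      toAny (there p)   e = there (toAny p e)

  length-split : ∀ {P : Pred A 0ℓ} (P? : Decidable P) (xs : List A) →
    length xs ≡ length (filter P? xs) + length (filter (λ x → ¬? (P? x)) xs)
  length-split P? [] = refl
  length-split P? (x ∷ xs) with P? x
  ... | yes _ = cong suc (length-split P? xs)
  ... | no _  = trans (cong suc (length-split P? xs)) (sym (+-suc _ _))

  filter-subsumed : ∀ {P Q : Pred A 0ℓ} (P? : Decidable P) (Q? : Decidable Q) →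
    (∀ {x} → P x → Q x) → ∀ (xs : List A) →
    length (filter P? (filter Q? xs)) ≡ length (filter P? xs)
  filter-subsumed P? Q? P⇒Q [] = refl
  filter-subsumed P? Q? P⇒Q (x ∷ xs) with Q? x
  ... | yes _ with P? x
  ...   | yes _ = cong suc (filter-subsumed P? Q? P⇒Q xs)
  ...   | no _  = filter-subsumed P? Q? P⇒Q xs
  filter-subsumed P? Q? P⇒Q (x ∷ xs) | no ¬q with P? x
  ...   | yes p = ⊥-elim (¬q (P⇒Q p))
  ...   | no _  = filter-subsumed P? Q? P⇒Q xs

  constant-fibres : (_≟ᵦ_ : DecidableEquality B) (φ : A → B) (s : ℕ) (T : List B) (L : List A) →
    Unique T → (∀ {x} → x ∈ L → φ x ∈ T) →
    (∀ {t} → t ∈ T → length (filter (λ x → φ x ≟ᵦ t) L) ≡ s) → length L ≡ length T * s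
  constant-fibres _≟ᵦ_ φ s [] [] _ _ _ = refl
  constant-fibres _≟ᵦ_ φ s [] (x ∷ L) _ into _ with into (here refl)
  ... | ()
  constant-fibres _≟ᵦ_ φ s (t ∷ T) L (t∉T ∷ uT) into fibre =
    trans (length-split (λ x → φ x ≟ᵦ t) L)
          (cong₂ _+_ (fibre (here refl)) (constant-fibres _≟ᵦ_ φ s T rest uT into′ fibre′))
    where
    rest = filter (λ x → ¬? (φ x ≟ᵦ t)) L
    into′ : ∀ {x} → x ∈ rest → φ x ∈ T
    into′ x∈rest with ∈-filter⁻ (λ x → ¬? (φ x ≟ᵦ t)) {xs = L} x∈rest
    ... | x∈L , φx≢t with into x∈L
    ...   | here φx≡t = ⊥-elim (φx≢t φx≡t)
    ...   | there φx∈T = φx∈T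
    fibre′ : ∀ {t′} → t′ ∈ T → length (filter (λ x → φ x ≟ᵦ t′) rest) ≡ s
    fibre′ t′∈T = trans
      (filter-subsumed (λ x → φ x ≟ᵦ _) (λ x → ¬? (φ x ≟ᵦ t))
        (λ e e′ → All.lookup t∉T t′∈T (trans (sym e′) e)) L)
      (fibre (there t′∈T))

open Counting

fin-injective⇒surjective : ∀ {n} (f : Fin n → Fin n) → Injective _≡_ _≡_ f → ∀ y → ∃ λ x → f x ≡ y
fin-injective⇒surjective {n} f inj y
  with injective⇒surjective _≟_ f (allFin⁺ n) (λ _ _ e → inj e) (λ _ → ∈-allFin _) (∈-allFin y)
... | x , _ , fx≡y = x , fx≡y

vec-ext : ∀ {A : Set} {n} {u v : Vec A n} → (∀ k → lookup u k ≡ lookup v k) → u ≡ v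
vec-ext {u = u} {v} h = trans (sym (tabulate∘lookup u)) (trans (tabulate-cong h) (tabulate∘lookup v))

module WreathProduct {m q : ℕ} where

  elt-ext : ∀ {g g′ : Elt m q} → (∀ k → perm g k ≡ perm g′ k) →
    (∀ k a → letter g k a ≡ letter g′ k a) → g ≡ g′
  elt-ext hp hl = cong₂ _,_ (vec-ext hp) (vec-ext (λ k → vec-ext (hl k)))

  perm-compose : ∀ (g₁ g₂ : Elt m q) k → perm (compose g₁ g₂) k ≡ perm g₂ (perm g₁ k)
  perm-compose g₁ g₂ k = lookup∘tabulate _ k

  letter-compose : ∀ (g₁ g₂ : Elt m q) k a →
    letter (compose g₁ g₂) k a ≡ letter g₁ k (letter g₂ (perm g₁ k) a)
  letter-compose g₁ g₂ k a =
    trans (cong (λ r → lookup r a) (lookup∘tabulate _ k)) (lookup∘tabulate _ a)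

  perm-id : ∀ k → perm (idE {m} {q}) k ≡ k
  perm-id k = lookup∘tabulate id k

  letter-id : ∀ k a → letter (idE {m} {q}) k a ≡ a
  letter-id k a = trans (cong (λ r → lookup r a) (lookup-replicate k (tabulate id))) (lookup∘tabulate id a)

  lookup-act : ∀ (g : Elt m q) v k → lookup (act g v) k ≡ letter g k (lookup v (perm g k))
  lookup-act g v k = lookup∘tabulate _ k

  act-compose : ∀ (g₁ g₂ : Elt m q) v → act (compose g₁ g₂) v ≡ act g₁ (act g₂ v)
  act-compose g₁ g₂ v = vec-ext λ k → begin
      lookup (act (compose g₁ g₂) v) k
    ≡⟨ lookup-act (compose g₁ g₂) v k ⟩
      letter (compose g₁ g₂) k (lookup v (perm (compose g₁ g₂) k))
    ≡⟨ cong (λ z → letter (compose g₁ g₂) k (lookup v z)) (perm-compose g₁ g₂ k) ⟩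
      letter (compose g₁ g₂) k (lookup v (perm g₂ (perm g₁ k)))
    ≡⟨ letter-compose g₁ g₂ k _ ⟩
      letter g₁ k (letter g₂ (perm g₁ k) (lookup v (perm g₂ (perm g₁ k))))
    ≡⟨ cong (letter g₁ k) (sym (lookup-act g₂ v (perm g₁ k))) ⟩
      letter g₁ k (lookup (act g₂ v) (perm g₁ k))
    ≡⟨ sym (lookup-act g₁ (act g₂ v) k) ⟩
      lookup (act g₁ (act g₂ v)) k ∎
    where open ≡-Reasoning

  act-id : ∀ v → act (idE {m} {q}) v ≡ v
  act-id v = vec-ext λ k →
    trans (lookup-act idE v k) (trans (letter-id k _) (cong (lookup v) (perm-id k)))

  act-inverse : ∀ (g h : Elt m q) → compose h g ≡ idE → ∀ v → act h (act g v) ≡ v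
  act-inverse g h hg≡id v = trans (sym (act-compose h g v)) (trans (cong (λ z → act z v) hg≡id) (act-id v))

  compose-assoc : ∀ (g₁ g₂ g₃ : Elt m q) → compose (compose g₁ g₂) g₃ ≡ compose g₁ (compose g₂ g₃)
  compose-assoc g₁ g₂ g₃ = elt-ext perms letters
    where
    open ≡-Reasoning
    perms : ∀ k → perm (compose (compose g₁ g₂) g₃) k ≡ perm (compose g₁ (compose g₂ g₃)) k
    perms k = begin
        perm (compose (compose g₁ g₂) g₃) k  ≡⟨ perm-compose (compose g₁ g₂) g₃ k ⟩
        perm g₃ (perm (compose g₁ g₂) k)     ≡⟨ cong (perm g₃) (perm-compose g₁ g₂ k) ⟩
        perm g₃ (perm g₂ (perm g₁ k))        ≡⟨ sym (perm-compose g₂ g₃ (perm g₁ k)) ⟩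
        perm (compose g₂ g₃) (perm g₁ k)     ≡⟨ sym (perm-compose g₁ (compose g₂ g₃) k) ⟩
        perm (compose g₁ (compose g₂ g₃)) k  ∎
    letters : ∀ k a → letter (compose (compose g₁ g₂) g₃) k a ≡ letter (compose g₁ (compose g₂ g₃)) k a
    letters k a = begin
        letter (compose (compose g₁ g₂) g₃) k a
      ≡⟨ letter-compose (compose g₁ g₂) g₃ k a ⟩
        letter (compose g₁ g₂) k (letter g₃ (perm (compose g₁ g₂) k) a)
      ≡⟨ letter-compose g₁ g₂ k _ ⟩
        letter g₁ k (letter g₂ (perm g₁ k) (letter g₃ (perm (compose g₁ g₂) k) a))
      ≡⟨ cong (λ z → letter g₁ k (letter g₂ (perm g₁ k) (letter g₃ z a))) (perm-compose g₁ g₂ k) ⟩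
        letter g₁ k (letter g₂ (perm g₁ k) (letter g₃ (perm g₂ (perm g₁ k)) a))
      ≡⟨ cong (letter g₁ k) (sym (letter-compose g₂ g₃ (perm g₁ k) a)) ⟩
        letter g₁ k (letter (compose g₂ g₃) (perm g₁ k) a)
      ≡⟨ sym (letter-compose g₁ (compose g₂ g₃) k a) ⟩
        letter (compose g₁ (compose g₂ g₃)) k a ∎

  compose-identityˡ : ∀ (g : Elt m q) → compose idE g ≡ g
  compose-identityˡ g = elt-ext
    (λ k → trans (perm-compose idE g k) (cong (perm g) (perm-id k)))
    (λ k a → trans (letter-compose idE g k a) (trans (letter-id k _) (cong (λ z → letter g z a) (perm-id k))))

  compose-identityʳ : ∀ (g : Elt m q) → compose g idE ≡ g
  compose-identityʳ g = elt-ext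
    (λ k → trans (perm-compose g idE k) (perm-id _))
    (λ k a → trans (letter-compose g idE k a) (cong (letter g k) (letter-id _ a)))

  left-cancel : ∀ (a : Elt m q) → IsAutH a → ∀ {g g′} → compose a g ≡ compose a g′ → g ≡ g′
  left-cancel a (perm-inj , letter-inj) {g} {g′} ag≡ag′ = elt-ext perms letters
    where
    perms : ∀ k′ → perm g k′ ≡ perm g′ k′
    perms k′ with fin-injective⇒surjective (perm a) perm-inj k′
    ... | k , refl = trans (sym (perm-compose a g k))
                       (trans (cong (λ h → perm h k) ag≡ag′) (perm-compose a g′ k))
    letters : ∀ k′ x → letter g k′ x ≡ letter g′ k′ x
    letters k′ x with fin-injective⇒surjective (perm a) perm-inj k′
    ... | k , refl = letter-inj k (trans (sym (letter-compose a g k x))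
                       (trans (cong (λ h → letter h k x) ag≡ag′) (letter-compose a g′ k x)))

  -- g carries the letter a in entry k to the letter a′ in entry k′
  -- (recall that mapsEntry g k k′ means perm g k′ ≡ k).
  Sends : Elt m q → Fin m → Fin q → Fin m → Fin q → Set
  Sends g k a k′ a′ = mapsEntry g k k′ × letter g k′ a ≡ a′

  mapsEntry-compose : ∀ (g₁ g₂ : Elt m q) {k k′ k″} →
    mapsEntry g₂ k k′ → mapsEntry g₁ k′ k″ → mapsEntry (compose g₁ g₂) k k″
  mapsEntry-compose g₁ g₂ {k″ = k″} p₂ p₁ =
    trans (perm-compose g₁ g₂ k″) (trans (cong (perm g₂) p₁) p₂)

  sends-compose : ∀ (g₁ g₂ : Elt m q) {k a k′ a′ k″ a″} →
    Sends g₂ k a k′ a′ → Sends g₁ k′ a′ k″ a″ → Sends (compose g₁ g₂) k a k″ a″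
  sends-compose g₁ g₂ {a = a} {k″ = k″} (p₂ , l₂) (p₁ , l₁) =
    mapsEntry-compose g₁ g₂ p₂ p₁ ,
    trans (letter-compose g₁ g₂ k″ a)
      (trans (cong (λ z → letter g₁ k″ (letter g₂ z a)) p₁) (trans (cong (letter g₁ k″) l₂) l₁))

  sends-inverse : ∀ (g h : Elt m q) {k a k′ a′} → compose g h ≡ idE → compose h g ≡ idE →
    Sends g k a k′ a′ → Sends h k′ a′ k a
  sends-inverse g h {k} {a} {k′} gh≡id hg≡id (p , l) =
    perm-hk ,
    trans (cong (letter h k) (sym l))
      (trans (cong (λ z → letter h k (letter g z a)) (sym perm-hk))
        (trans (sym (letter-compose h g k a)) (trans (cong (λ z → letter z k a) hg≡id) (letter-id k a))))
    where
    perm-hk : perm h k ≡ k′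
    perm-hk = trans (cong (perm h) (sym p))
      (trans (sym (perm-compose g h k′)) (trans (cong (λ z → perm z k′) gh≡id) (perm-id k′)))

  read-entry : ∀ (g : Elt m q) u {v} → act g u ≡ v → ∀ {s t} → mapsEntry g s t →
    lookup v t ≡ letter g t (lookup u s)
  read-entry g u gu≡v {t = t} p =
    trans (cong (λ w → lookup w t) (sym gu≡v)) (trans (lookup-act g u t) (cong (λ z → letter g t (lookup u z)) p))

  sends-from : ∀ (g : Elt m q) u {v} → act g u ≡ v → ∀ {s t x y} → mapsEntry g s t →
    lookup u s ≡ x → lookup v t ≡ y → Sends g s x t y
  sends-from g u gu≡v {t = t} s↦t at-s at-t =
    s↦t , trans (cong (letter g t) (sym at-s)) (trans (sym (read-entry g u gu≡v s↦t)) at-t)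

open WreathProduct

-- The Hamming distance of Defs counts differing entries through a filter;
-- its recursive form gives symmetry and the triangle inequality, and the
-- filter form shows that automorphisms do not increase distances.
module HammingDistance where

  differ : ∀ {q} → Fin q → Fin q → ℕ
  differ x y with x ≟ y
  ... | yes _ = 0
  ... | no _  = 1

  hamming : ∀ {m q} → Vec (Fin q) m → Vec (Fin q) m → ℕ
  hamming []       []       = 0
  hamming (x ∷ u) (y ∷ v) = differ x y + hamming u v

  differing-suc : ∀ {m q} (u v : Vec (Fin q) m) (x y : Fin q) n (f : Fin n → Fin m) →
    length (filter (λ k → ¬? (lookup (x ∷ u) k ≟ lookup (y ∷ v) k)) (List.tabulate (suc ∘ f)))
    ≡ length (filter (λ k → ¬? (lookup u k ≟ lookup v k)) (List.tabulate f))
  differing-suc u v x y zero    f = refl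
  differing-suc u v x y (suc n) f with lookup u (f zero) ≟ lookup v (f zero)
  ... | yes _ = differing-suc u v x y n (f ∘ suc)
  ... | no _  = cong suc (differing-suc u v x y n (f ∘ suc))

  dist≡hamming : ∀ {m q} (u v : Vec (Fin q) m) → dist u v ≡ hamming u v
  dist≡hamming [] [] = refl
  dist≡hamming {suc m} (x ∷ u) (y ∷ v) with x ≟ y
  ... | yes _ = trans (differing-suc u v x y m id) (dist≡hamming u v)
  ... | no _  = cong suc (trans (differing-suc u v x y m id) (dist≡hamming u v))

  differ-sym : ∀ {q} (x y : Fin q) → differ x y ≡ differ y x
  differ-sym x y with x ≟ y | y ≟ x
  ... | yes _   | yes _   = refl
  ... | yes x≡y | no y≢x  = ⊥-elim (y≢x (sym x≡y))
  ... | no x≢y  | yes y≡x = ⊥-elim (x≢y (sym y≡x))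
  ... | no _    | no _    = refl

  differ-triangle : ∀ {q} (x y z : Fin q) → differ x z ≤ differ x y + differ y z
  differ-triangle x y z with x ≟ z | x ≟ y | y ≟ z
  ... | yes _ | _        | _        = z≤n
  ... | no _  | no _     | _        = s≤s z≤n
  ... | no _  | yes _    | no _     = s≤s z≤n
  ... | no x≢z | yes refl | yes refl = ⊥-elim (x≢z refl)

  hamming-sym : ∀ {m q} (u v : Vec (Fin q) m) → hamming u v ≡ hamming v u
  hamming-sym []      []      = refl
  hamming-sym (x ∷ u) (y ∷ v) = cong₂ _+_ (differ-sym x y) (hamming-sym u v)

  hamming-triangle : ∀ {m q} (u v w : Vec (Fin q) m) → hamming u w ≤ hamming u v + hamming v w
  hamming-triangle []      []      []      = z≤n
  hamming-triangle (x ∷ u) (y ∷ v) (z ∷ w) =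
    ≤-trans (+-mono-≤ (differ-triangle x y z) (hamming-triangle u v w))
            (≤-reflexive (interchange (differ x y) (differ y z) (hamming u v) (hamming v w)))
    where
    interchange : ∀ a b c d → (a + b) + (c + d) ≡ (a + c) + (b + d)
    interchange = solve-∀

  dist-sym : ∀ {m q} (u v : Vec (Fin q) m) → dist u v ≡ dist v u
  dist-sym u v = trans (dist≡hamming u v) (trans (hamming-sym u v) (sym (dist≡hamming v u)))

  dist-triangle : ∀ {m q} (u v w : Vec (Fin q) m) → dist u w ≤ dist u v + dist v w
  dist-triangle u v w = subst₂ (λ a b → a ≤ b + dist v w) (sym (dist≡hamming u w)) (sym (dist≡hamming u v))
    (subst (λ c → hamming u w ≤ hamming u v + c) (sym (dist≡hamming v w)) (hamming-triangle u v w))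

  -- An automorphism maps the entries where g·u and g·v differ injectively
  -- (by perm g) to entries where u and v differ.
  non-expanding : ∀ {m q} (g : Elt m q) → IsAutH g → ∀ u v → dist (act g u) (act g v) ≤ dist u v
  non-expanding {m} g (perm-inj , _) u v =
    injection⇒length≤ (perm g) (filter⁺ _ (allFin⁺ m)) (λ _ _ e → perm-inj e) into
    where
    into : ∀ {k} → k ∈ filter (λ k → ¬? (lookup (act g u) k ≟ lookup (act g v) k)) (allFin m) →
      perm g k ∈ filter (λ k → ¬? (lookup u k ≟ lookup v k)) (allFin m)
    into {k} k∈ with ∈-filter⁻ (λ k → ¬? (lookup (act g u) k ≟ lookup (act g v) k)) {xs = allFin m} k∈
    ... | _ , differs = ∈-filter⁺ (λ k → ¬? (lookup u k ≟ lookup v k)) (∈-allFin _)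
      (λ same → differs (trans (lookup-act g u k) (trans (cong (letter g k) same) (sym (lookup-act g v k)))))

open HammingDistance

record IsFiniteGroup {m q} (G : List (Elt m q)) : Set where
  field
    unique  : Unique G
    auts    : ∀ {g} → g ∈ G → IsAutH g
    closed  : ∀ {g h} → g ∈ G → h ∈ G → compose g h ∈ G
    inverse : ∀ {g} → g ∈ G → ∃ λ h → h ∈ G × compose g h ≡ idE × compose h g ≡ idE

_≟e_ : ∀ {m q} → DecidableEquality (Elt m q)
_≟e_ = ≡-dec-× (≡-dec-vec _≟_) (≡-dec-vec (≡-dec-vec _≟_))

-- A subset closed under composition is a group: g ∘_ is injective on X,
-- hence onto X by pigeonhole, so g has a right inverse; a right inverse of
-- a right inverse of g is g itself, giving a two-sided inverse.
subgroup⇒group : ∀ {m q} {X : List (Elt m q)} → IsSubgroup X → IsFiniteGroup X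
subgroup⇒group {X = X} sg = record
  { unique = unique ; auts = λ {g} → auts g ; closed = λ {g} {h} → closed g h ; inverse = two-sided }
  where
  open IsSubgroup sg
  right-inverse : ∀ {g} → g ∈ X → ∃ λ h → h ∈ X × compose g h ≡ idE
  right-inverse {g} g∈X = injective⇒surjective _≟e_ (compose g) unique
    (λ _ _ e → left-cancel g (auts g g∈X) e) (λ {h} h∈X → closed g h g∈X h∈X) idIn
  two-sided : ∀ {g} → g ∈ X → ∃ λ h → h ∈ X × compose g h ≡ idE × compose h g ≡ idE
  two-sided {g} g∈X with right-inverse g∈X
  ... | h , h∈X , gh≡id with right-inverse h∈X
  ...   | k , _ , hk≡id = h , h∈X , gh≡id , trans (cong (compose h) g≡k) hk≡id
    where
    open ≡-Reasoning
    g≡k : g ≡ k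
    g≡k = begin
      g                        ≡⟨ sym (compose-identityʳ g) ⟩
      compose g idE            ≡⟨ cong (compose g) (sym hk≡id) ⟩
      compose g (compose h k)  ≡⟨ sym (compose-assoc g h k) ⟩
      compose (compose g h) k  ≡⟨ cong (λ z → compose z k) gh≡id ⟩
      compose idE k            ≡⟨ compose-identityˡ k ⟩
      k                        ∎

-- the stabiliser G_w of the vertex w; note stab0 X is stabiliser X 0
stabiliser : ∀ {m q} → List (Elt m q) → Vertex m q → List (Elt m q)
stabiliser G w = filter (λ g → act g w ≟v w) G

module FiniteGroup {m q} {G : List (Elt m q)} (isG : IsFiniteGroup G) where
  open IsFiniteGroup isG

  -- g and its inverse are both non-expanding, so g preserves distances
  isometry : ∀ {g} → g ∈ G → ∀ u v → dist (act g u) (act g v) ≡ dist u v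
  isometry {g} g∈G u v with inverse g∈G
  ... | h , h∈G , _ , hg≡id = ≤-antisym (non-expanding g (auts g∈G) u v)
    (subst₂ (λ x y → dist x y ≤ dist (act g u) (act g v)) (act-inverse g h hg≡id u) (act-inverse g h hg≡id v)
      (non-expanding h (auts h∈G) (act g u) (act g v)))

  stabiliser⁻ : ∀ {w g} → g ∈ stabiliser G w → g ∈ G × act g w ≡ w
  stabiliser⁻ {w} = ∈-filter⁻ (λ g → act g w ≟v w) {xs = G}

  stabiliser⁺ : ∀ {w g} → g ∈ G → act g w ≡ w → g ∈ stabiliser G w
  stabiliser⁺ {w} = ∈-filter⁺ (λ g → act g w ≟v w)

  stabiliser-group : ∀ w → IsFiniteGroup (stabiliser G w)
  stabiliser-group w = record
    { unique  = filter⁺ (λ g → act g w ≟v w) unique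
    ; auts    = λ g∈ → auts (proj₁ (stabiliser⁻ g∈))
    ; closed  = λ {g} {h} g∈ h∈ → let (g∈G , gw) = stabiliser⁻ g∈ ; (h∈G , hw) = stabiliser⁻ h∈ in
        stabiliser⁺ (closed g∈G h∈G) (trans (act-compose g h w) (trans (cong (act g) hw) gw))
    ; inverse = λ {g} g∈ → let (g∈G , gw) = stabiliser⁻ g∈ ; (h , h∈G , gh , hg) = inverse g∈G in
        h , stabiliser⁺ h∈G (trans (cong (act h) (sym gw)) (act-inverse g h hg w)) , gh , hg
    }

  fibre : Vertex m q → Vertex m q → List (Elt m q)
  fibre w t = filter (λ g → act g w ≟v t) G

  -- left multiplication by a ∈ G embeds the fibre over t into that over a·t
  fibre-≤ : ∀ {a} → a ∈ G → ∀ w t → length (fibre w t) ≤ length (fibre w (act a t))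
  fibre-≤ {a} a∈G w t = injection⇒length≤ (compose a) (filter⁺ (λ g → act g w ≟v t) unique)
    (λ _ _ e → left-cancel a (auts a∈G) e) into
    where
    into : ∀ {g} → g ∈ fibre w t → compose a g ∈ fibre w (act a t)
    into {g} g∈ with ∈-filter⁻ (λ g → act g w ≟v t) {xs = G} g∈
    ... | g∈G , gw≡t = ∈-filter⁺ (λ g → act g w ≟v act a t) (closed a∈G g∈G)
      (trans (act-compose a g w) (cong (act a) gw≡t))

  fibre≡stabiliser : ∀ {g} → g ∈ G → ∀ w → length (fibre w (act g w)) ≡ length (stabiliser G w)
  fibre≡stabiliser {g} g∈G w with inverse g∈G
  ... | h , h∈G , _ , hg≡id = ≤-antisym
    (subst (λ v → length (fibre w (act g w)) ≤ length (fibre w v)) (act-inverse g h hg≡id w)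
       (fibre-≤ h∈G w (act g w)))
    (fibre-≤ g∈G w w)

  orbit-stabiliser : ∀ w (T : List (Vertex m q)) → Unique T →
    (∀ {g} → g ∈ G → act g w ∈ T) → (∀ {t} → t ∈ T → ∃ λ g → g ∈ G × act g w ≡ t) →
    length G ≡ length T * length (stabiliser G w)
  orbit-stabiliser w T uT into onto = constant-fibres _≟v_ (λ g → act g w) _ T G uT into fibre-size
    where
    fibre-size : ∀ {t} → t ∈ T → length (fibre w t) ≡ length (stabiliser G w)
    fibre-size t∈T with onto t∈T
    ... | g , g∈G , refl = fibre≡stabiliser g∈G w

  stabiliser∣group : ∀ w → length (stabiliser G w) ∣ length G
  stabiliser∣group w = divides (length orbit) (orbit-stabiliser w orbit (deduplicate-! _≟v_ _)
      (λ g∈G → ∈-deduplicate⁺ _≟v_ (∈-map⁺ (λ g → act g w) g∈G))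
      (λ t∈ → let (g , g∈G , t≡gw) = ∈-map⁻ (λ g → act g w) (∈-deduplicate⁻ _≟v_ _ t∈)
              in g , g∈G , sym t≡gw))
    where
    orbit = deduplicate _≟v_ (map (λ g → act g w) G)

module WeightTwo where

  weight : ∀ {m n} → Vec (Fin (suc n)) m → ℕ
  weight {m} v = hamming v (replicate m zero)

  dist-zero≡weight : ∀ {m n} (v : Vec (Fin (suc n)) m) → dist v (replicate m zero) ≡ weight v
  dist-zero≡weight v = dist≡hamming v _

  weight≡0 : ∀ {n m} (v : Vec (Fin (suc n)) m) → weight v ≡ 0 → v ≡ replicate m zero
  weight≡0 []          _  = refl
  weight≡0 (zero ∷ v)  w0 = cong (zero ∷_) (weight≡0 v w0)
  weight≡0 (suc _ ∷ v) ()

  weight-zero : ∀ {n} m → weight {m} {n} (replicate m zero) ≡ 0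
  weight-zero zero    = refl
  weight-zero (suc m) = weight-zero m

  weightOneVertices : ∀ n m → List (Vec (Fin (suc n)) m)
  weightOneVertices n zero    = []
  weightOneVertices n (suc m) =
    map (λ a → suc a ∷ replicate m zero) (allFin n) ++ map (zero ∷_) (weightOneVertices n m)

  weightTwoVertices : ∀ n m → List (Vec (Fin (suc n)) m)
  weightTwoVertices n zero    = []
  weightTwoVertices n (suc m) =
    cartesianProductWith (λ a v → suc a ∷ v) (allFin n) (weightOneVertices n m)
    ++ map (zero ∷_) (weightTwoVertices n m)

  length-cartesianProductWith : ∀ {A B C : Set} (f : A → B → C) xs ys →
    length (cartesianProductWith f xs ys) ≡ length xs * length ys
  length-cartesianProductWith f []       ys = refl
  length-cartesianProductWith f (x ∷ xs) ys =
    trans (length-++ (map (f x) ys)) (cong₂ _+_ (length-map (f x) ys) (length-cartesianProductWith f xs ys))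

  length-allFin : ∀ n → length (allFin n) ≡ n
  length-allFin n = length-tabulate id

  length-weightOne : ∀ n m → length (weightOneVertices n m) ≡ m * n
  length-weightOne n zero    = refl
  length-weightOne n (suc m) = trans (length-++ (map (λ a → suc a ∷ replicate m zero) (allFin n)))
    (cong₂ _+_ (trans (length-map _ (allFin n)) (length-allFin n))
               (trans (length-map _ (weightOneVertices n m)) (length-weightOne n m)))

  -- Pascal's rule  (m choose 1) + (m choose 2) = (m+1 choose 2)  drives the count.
  length-weightTwo : ∀ n m → length (weightTwoVertices n m) ≡ (m C 2) * n ^ 2
  length-weightTwo n zero    = refl
  length-weightTwo n (suc m) = begin
      length (weightTwoVertices n (suc m))
    ≡⟨ length-++ (cartesianProductWith (λ a v → suc a ∷ v) (allFin n) (weightOneVertices n m)) ⟩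
      length (cartesianProductWith (λ a v → suc a ∷ v) (allFin n) (weightOneVertices n m))
        + length (map (zero ∷_) (weightTwoVertices n m))
    ≡⟨ cong₂ _+_ (trans (length-cartesianProductWith _ (allFin n) (weightOneVertices n m))
                        (cong₂ _*_ (length-allFin n) (length-weightOne n m)))
                 (trans (length-map _ (weightTwoVertices n m)) (length-weightTwo n m)) ⟩
      n * (m * n) + (m C 2) * n ^ 2
    ≡⟨ regroup n m (m C 2) ⟩
      (m + m C 2) * n ^ 2
    ≡⟨ cong (_* n ^ 2) (trans (cong (_+ m C 2) (sym (nC1≡n m))) (nCk+nC[k+1]≡[n+1]C[k+1] m 1)) ⟩
      (suc m C 2) * n ^ 2 ∎
    where
    open ≡-Reasoning
    regroup : ∀ n m c → n * (m * n) + c * (n * (n * 1)) ≡ (m + c) * (n * (n * 1))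
    regroup = solve-∀

  ∈-weightOne : ∀ {n m} (v : Vec (Fin (suc n)) m) → weight v ≡ 1 → v ∈ weightOneVertices n m
  ∈-weightOne (zero ∷ v) w1 = ∈-++⁺ʳ _ (∈-map⁺ (zero ∷_) (∈-weightOne v w1))
  ∈-weightOne {n} {suc m} (suc a ∷ v) w1 =
    ∈-++⁺ˡ (subst (λ u → suc a ∷ u ∈ map (λ a → suc a ∷ replicate m zero) (allFin n))
                  (sym (weight≡0 v (cong pred w1)))
                  (∈-map⁺ (λ a → suc a ∷ replicate m zero) (∈-allFin a)))

  ∈-weightTwo : ∀ {n m} (v : Vec (Fin (suc n)) m) → weight v ≡ 2 → v ∈ weightTwoVertices n m
  ∈-weightTwo (zero ∷ v) w2 = ∈-++⁺ʳ _ (∈-map⁺ (zero ∷_) (∈-weightTwo v w2))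
  ∈-weightTwo (suc a ∷ v) w2 =
    ∈-++⁺ˡ (∈-cartesianProductWith⁺ (λ a v → suc a ∷ v) (∈-allFin a) (∈-weightOne v (cong pred w2)))

  weightOne-unique : ∀ n m → Unique (weightOneVertices n m)
  weightOne-unique n zero    = []
  weightOne-unique n (suc m) =
    ++⁺ (map⁺ (λ e → suc-injective (∷-injectiveˡ e)) (allFin⁺ n))
        (map⁺ ∷-injectiveʳ (weightOne-unique n m)) disjoint
    where
    disjoint : ∀ {v} → ¬ (v ∈ map (λ a → suc a ∷ replicate m zero) (allFin n)
                          × v ∈ map (zero ∷_) (weightOneVertices n m))
    disjoint (v∈₁ , v∈₂)
      with ∈-map⁻ (λ a → suc a ∷ replicate m zero) v∈₁ | ∈-map⁻ (zero ∷_) v∈₂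
    ... | _ , _ , refl | _ , _ , ()

  weightTwo-unique : ∀ n m → Unique (weightTwoVertices n m)
  weightTwo-unique n zero    = []
  weightTwo-unique n (suc m) =
    ++⁺ (cartesianProductWith⁺ (λ a v → suc a ∷ v) (λ e → suc-injective (∷-injectiveˡ e) , ∷-injectiveʳ e)
          (allFin⁺ n) (weightOne-unique n m))
        (map⁺ ∷-injectiveʳ (weightTwo-unique n m)) disjoint
    where
    disjoint : ∀ {v} → ¬ (v ∈ cartesianProductWith (λ a v → suc a ∷ v) (allFin n) (weightOneVertices n m)
                          × v ∈ map (zero ∷_) (weightTwoVertices n m))
    disjoint (v∈₁ , v∈₂)
      with ∈-cartesianProductWith⁻ (λ a v → suc a ∷ v) (allFin n) (weightOneVertices n m) v∈₁
         | ∈-map⁻ (zero ∷_) v∈₂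
    ... | _ , _ , _ , _ , refl | _ , _ , ()

  weightOne-sound : ∀ {n m} {v : Vec (Fin (suc n)) m} → v ∈ weightOneVertices n m → weight v ≡ 1
  weightOne-sound {n} {suc m} v∈ with ∈-++⁻ (map (λ a → suc a ∷ replicate m zero) (allFin n)) v∈
  ... | inj₁ v∈₁ with ∈-map⁻ (λ a → suc a ∷ replicate m zero) v∈₁
  ...   | _ , _ , refl = cong suc (weight-zero m)
  weightOne-sound {n} {suc m} v∈ | inj₂ v∈₂ with ∈-map⁻ (zero ∷_) v∈₂
  ...   | _ , u∈ , refl = weightOne-sound u∈

  weightTwo-sound : ∀ {n m} {v : Vec (Fin (suc n)) m} → v ∈ weightTwoVertices n m → weight v ≡ 2
  weightTwo-sound {n} {suc m} v∈
    with ∈-++⁻ (cartesianProductWith (λ a v → suc a ∷ v) (allFin n) (weightOneVertices n m)) v∈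
  ... | inj₁ v∈₁ with ∈-cartesianProductWith⁻ (λ a v → suc a ∷ v) (allFin n) (weightOneVertices n m) v∈₁
  ...   | _ , _ , _ , u∈ , refl = cong suc (weightOne-sound u∈)
  weightTwo-sound {n} {suc m} v∈ | inj₂ v∈₂ with ∈-map⁻ (zero ∷_) v∈₂
  ...   | _ , u∈ , refl = weightTwo-sound u∈

  pairEntry : ∀ {m n} → Fin m → Fin (suc n) → Fin m → Fin (suc n) → Fin m → Fin (suc n)
  pairEntry k a l b t with t ≟ k | t ≟ l
  ... | yes _ | _     = a
  ... | no _  | yes _ = b
  ... | no _  | no _  = zero

  pairVertex : ∀ {m n} → Fin m → Fin (suc n) → Fin m → Fin (suc n) → Vec (Fin (suc n)) m
  pairVertex k a l b = tabulate (pairEntry k a l b)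

  module _ {m n} (k l : Fin m) (a b : Fin (suc n)) where

    pairVertex-at₁ : lookup (pairVertex k a l b) k ≡ a
    pairVertex-at₁ = trans (lookup∘tabulate (pairEntry k a l b) k) entry-k
      where
      entry-k : pairEntry k a l b k ≡ a
      entry-k with k ≟ k
      ... | yes _  = refl
      ... | no k≢k = ⊥-elim (k≢k refl)

    pairVertex-at₂ : k ≢ l → lookup (pairVertex k a l b) l ≡ b
    pairVertex-at₂ k≢l = trans (lookup∘tabulate (pairEntry k a l b) l) entry-l
      where
      entry-l : pairEntry k a l b l ≡ b
      entry-l with l ≟ k | l ≟ l
      ... | yes l≡k | _      = ⊥-elim (k≢l (sym l≡k))
      ... | no _    | yes _  = refl
      ... | no _    | no l≢l = ⊥-elim (l≢l refl)

    pairVertex-support : ∀ t → lookup (pairVertex k a l b) t ≢ zero → t ≡ k ⊎ t ≡ l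
    pairVertex-support t nonzero with t ≟ k in eq-k | t ≟ l in eq-l
    ... | yes t≡k | _       = inj₁ t≡k
    ... | no _    | yes t≡l = inj₂ t≡l
    ... | no _    | no _    = ⊥-elim (nonzero (trans (lookup∘tabulate (pairEntry k a l b) t) entry-t))
      where
      entry-t : pairEntry k a l b t ≡ zero
      entry-t rewrite eq-k | eq-l = refl

    weight-pairVertex : k ≢ l → a ≢ zero → b ≢ zero → weight (pairVertex k a l b) ≡ 2
    weight-pairVertex k≢l a≢0 b≢0 = trans (sym (dist-zero≡weight v)) (≤-antisym at-most at-least)
      where
      v = pairVertex k a l b
      differs = λ t → ¬? (lookup v t ≟ lookup (replicate m zero) t)
      at-most : dist v (replicate m zero) ≤ 2
      at-most = injection⇒length≤ {ys = k ∷ l ∷ []} id (filter⁺ differs (allFin⁺ m)) (λ _ _ e → e) into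
        where
        into : ∀ {t} → t ∈ filter differs (allFin m) → t ∈ k ∷ l ∷ []
        into {t} t∈ with pairVertex-support t (λ e → proj₂ (∈-filter⁻ differs {xs = allFin m} t∈)
                                                       (trans e (sym (lookup-replicate t zero))))
        ... | inj₁ t≡k = here t≡k
        ... | inj₂ t≡l = there (here t≡l)
      at-least : 2 ≤ dist v (replicate m zero)
      at-least = injection⇒length≤ {xs = k ∷ l ∷ []} id ((k≢l ∷ []) ∷ [] ∷ []) (λ _ _ e → e) into
        where
        into : ∀ {t} → t ∈ k ∷ l ∷ [] → t ∈ filter differs (allFin m)
        into (here refl) = ∈-filter⁺ differs (∈-allFin k)
          (λ e → a≢0 (trans (sym pairVertex-at₁) (trans e (lookup-replicate k zero))))
        into (there (here refl)) = ∈-filter⁺ differs (∈-allFin l)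
          (λ e → b≢0 (trans (sym (pairVertex-at₂ k≢l)) (trans e (lookup-replicate l zero))))

open WeightTwo

-- From now on C is an (X,2)-neighbour-transitive code in H(m, q) with
-- minimum distance δ ≥ 5 and 0 ∈ C, over an alphabet of size q = p + 2
-- (the alphabet has a nonzero letter, 1).
module NeighbourTransitiveCode {m p : ℕ} {X : List (Elt m (suc (suc p)))} {𝒞 : Code m (suc (suc p))} {δ : ℕ}
  (subgroup : IsSubgroup X) (X≤AutC : X ≤AutC 𝒞) (2-nt : TwoNT X 𝒞)
  (minDist : MinDist 𝒞 δ) (5≤δ : 5 ≤ δ) (𝟎∈C : 𝒞 (zeroV m (suc p)) ≡ true) where

  𝟎 : Vertex m (suc (suc p))
  𝟎 = zeroV m (suc p)

  X₀ : List (Elt m (suc (suc p)))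
  X₀ = stab0 X

  groupX : IsFiniteGroup X
  groupX = subgroup⇒group subgroup

  module GX = FiniteGroup groupX

  group₀ : IsFiniteGroup X₀
  group₀ = GX.stabiliser-group 𝟎

  module G₀ = FiniteGroup group₀

  open IsFiniteGroup group₀ using () renaming (auts to auts₀; closed to closed₀; inverse to inverse₀)

  letter-zero : ∀ {g} → g ∈ X₀ → ∀ k → letter g k zero ≡ zero
  letter-zero {g} g∈X₀ k = begin
      letter g k zero                   ≡⟨ cong (letter g k) (sym (lookup-replicate (perm g k) zero)) ⟩
      letter g k (lookup 𝟎 (perm g k))  ≡⟨ sym (lookup-act g 𝟎 k) ⟩
      lookup (act g 𝟎) k                ≡⟨ cong (λ v → lookup v k) (proj₂ (GX.stabiliser⁻ g∈X₀)) ⟩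
      lookup 𝟎 k                        ≡⟨ lookup-replicate k zero ⟩
      zero                              ∎
    where open ≡-Reasoning

  weight-invariant : ∀ {g} → g ∈ X₀ → ∀ v → weight (act g v) ≡ weight v
  weight-invariant {g} g∈X₀ v = begin
      weight (act g v)            ≡⟨ sym (dist-zero≡weight (act g v)) ⟩
      dist (act g v) 𝟎            ≡⟨ cong (dist (act g v)) (sym (proj₂ (GX.stabiliser⁻ g∈X₀))) ⟩
      dist (act g v) (act g 𝟎)    ≡⟨ GX.isometry (proj₁ (GX.stabiliser⁻ g∈X₀)) v 𝟎 ⟩
      dist v 𝟎                    ≡⟨ dist-zero≡weight v ⟩
      weight v                    ∎
    where open ≡-Reasoning

  far-from-𝟎 : ∀ {c} → 𝒞 c ≡ true → c ≢ 𝟎 → 5 ≤ dist 𝟎 c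
  far-from-𝟎 c∈C c≢𝟎 = ≤-trans 5≤δ (proj₂ minDist 𝟎 _ 𝟎∈C c∈C (λ 𝟎≡c → c≢𝟎 (sym 𝟎≡c)))

  -- Since δ ≥ 5, a weight-two vertex is at distance 2 from 0 and at least
  -- 3 from every other codeword, so it lies in C₂.
  weightTwo⇒C₂ : ∀ u → weight u ≡ 2 → InCs 𝒞 2 u
  weightTwo⇒C₂ u wu = (𝟎 , 𝟎∈C , d-u𝟎) , at-least-2
    where
    d-u𝟎 : dist u 𝟎 ≡ 2
    d-u𝟎 = trans (dist-zero≡weight u) wu
    at-least-2 : ∀ c → 𝒞 c ≡ true → 2 ≤ dist u c
    at-least-2 c c∈C with c ≟v 𝟎
    ... | yes refl = ≤-reflexive (sym d-u𝟎)
    ... | no c≢𝟎   = ≤-trans (n≤1+n 2) (+-cancelˡ-≤ 2 3 (dist u c)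
        (≤-trans (far-from-𝟎 c∈C c≢𝟎)
          (≤-trans (dist-triangle 𝟎 u c) (≤-reflexive (cong (_+ dist u c) (trans (dist-sym 𝟎 u) d-u𝟎))))))

  -- X₀ is transitive on weight-two vertices: X is transitive on C₂, and an
  -- element g of X carrying one weight-two vertex to another moves 0 at most
  -- distance 4, so g fixes the codeword 0.
  X₀-transitive : ∀ u v → weight u ≡ 2 → weight v ≡ 2 → ∃ λ g → g ∈ X₀ × act g u ≡ v
  X₀-transitive u v wu wv with proj₂ (proj₂ 2-nt) u v (weightTwo⇒C₂ u wu) (weightTwo⇒C₂ v wv)
  ... | g , g∈X , gu≡v with act g 𝟎 ≟v 𝟎
  ...   | yes g𝟎≡𝟎 = g , GX.stabiliser⁺ g∈X g𝟎≡𝟎 , gu≡v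
  ...   | no g𝟎≢𝟎  = ⊥-elim (5≰4 (≤-trans (far-from-𝟎 g𝟎∈C g𝟎≢𝟎) d-𝟎g𝟎≤4))
    where
    g𝟎∈C : 𝒞 (act g 𝟎) ≡ true
    g𝟎∈C = trans (X≤AutC g g∈X 𝟎) 𝟎∈C
    d-vg𝟎 : dist v (act g 𝟎) ≡ 2
    d-vg𝟎 = trans (cong (λ w → dist w (act g 𝟎)) (sym gu≡v))
              (trans (GX.isometry g∈X u 𝟎) (trans (dist-zero≡weight u) wu))
    d-𝟎g𝟎≤4 : dist 𝟎 (act g 𝟎) ≤ 4
    d-𝟎g𝟎≤4 = ≤-trans (dist-triangle 𝟎 v (act g 𝟎))
      (≤-reflexive (cong₂ _+_ (trans (dist-sym 𝟎 v) (trans (dist-zero≡weight v) wv)) d-vg𝟎))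
    5≰4 : ¬ (5 ≤ 4)
    5≰4 (s≤s (s≤s (s≤s (s≤s ()))))

  MovesPair : Elt m (suc (suc p)) → (k : Fin m) (a : Fin (suc (suc p))) (l : Fin m) (b : Fin (suc (suc p))) →
    (k′ : Fin m) (a′ : Fin (suc (suc p))) (l′ : Fin m) (b′ : Fin (suc (suc p))) → Set
  MovesPair g k a l b k′ a′ l′ b′ =
    (Sends g k a k′ a′ × Sends g l b l′ b′) ⊎ (Sends g l b k′ a′ × Sends g k a l′ b′)

  -- An element of X₀ fixes 0 letterwise, so the support {k′, l′} of the image
  -- comes from the support {k, l}; injectivity on entries gives the two cases.
  moves-pair : ∀ {g} → g ∈ X₀ → ∀ {k a l b k′ a′ l′ b′} →
    act g (pairVertex k a l b) ≡ pairVertex k′ a′ l′ b′ →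
    k ≢ l → k′ ≢ l′ → a′ ≢ zero → b′ ≢ zero →
    MovesPair g k a l b k′ a′ l′ b′
  moves-pair {g} g∈X₀ {k} {a} {l} {b} {k′} {a′} {l′} {b′} g-moves k≢l k′≢l′ a′≢0 b′≢0
    with from-support (pairVertex-at₁ k′ l′ a′ b′) a′≢0
       | from-support (pairVertex-at₂ k′ l′ a′ b′ k′≢l′) b′≢0
    where
    from-support : ∀ {t c} → lookup (pairVertex k′ a′ l′ b′) t ≡ c → c ≢ zero →
      perm g t ≡ k ⊎ perm g t ≡ l
    from-support {t} at-t c≢0 = pairVertex-support k l a b (perm g t) λ source≡0 → c≢0 (begin
      _                                                    ≡⟨ sym at-t ⟩
      lookup (pairVertex k′ a′ l′ b′) t                    ≡⟨ read-entry g (pairVertex k a l b) g-moves refl ⟩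
      letter g t (lookup (pairVertex k a l b) (perm g t))  ≡⟨ cong (letter g t) source≡0 ⟩
      letter g t zero                                      ≡⟨ letter-zero g∈X₀ t ⟩
      zero                                                 ∎)
      where open ≡-Reasoning
  ... | inj₁ k′↦k | inj₁ l′↦k = ⊥-elim (k′≢l′ (proj₁ (auts₀ g∈X₀) (trans k′↦k (sym l′↦k))))
  ... | inj₂ k′↦l | inj₂ l′↦l = ⊥-elim (k′≢l′ (proj₁ (auts₀ g∈X₀) (trans k′↦l (sym l′↦l))))
  ... | inj₁ k′↦k | inj₂ l′↦l =
    inj₁ (sends k′↦k (pairVertex-at₁ k l a b) (pairVertex-at₁ k′ l′ a′ b′) ,
          sends l′↦l (pairVertex-at₂ k l a b k≢l) (pairVertex-at₂ k′ l′ a′ b′ k′≢l′))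
    where sends = sends-from g (pairVertex k a l b) g-moves
  ... | inj₂ k′↦l | inj₁ l′↦k =
    inj₂ (sends k′↦l (pairVertex-at₂ k l a b k≢l) (pairVertex-at₁ k′ l′ a′ b′) ,
          sends l′↦k (pairVertex-at₁ k l a b) (pairVertex-at₂ k′ l′ a′ b′ k′≢l′))
    where sends = sends-from g (pairVertex k a l b) g-moves

  one : Fin (suc (suc p))
  one = suc zero

  one≢0 : one ≢ zero
  one≢0 ()

  pair-transitive : ∀ {k a l b k′ a′ l′ b′} → k ≢ l → k′ ≢ l′ →
    a ≢ zero → b ≢ zero → a′ ≢ zero → b′ ≢ zero →
    ∃ λ g → g ∈ X₀ × MovesPair g k a l b k′ a′ l′ b′
  pair-transitive {k} {a} {l} {b} {k′} {a′} {l′} {b′} k≢l k′≢l′ a≢0 b≢0 a′≢0 b′≢0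
    = case X₀-transitive (pairVertex k a l b) (pairVertex k′ a′ l′ b′)
             (weight-pairVertex k l a b k≢l a≢0 b≢0)
             (weight-pairVertex k′ l′ a′ b′ k′≢l′ a′≢0 b′≢0) of λ where
      (g , g∈X₀ , g-moves) → g , g∈X₀ , moves-pair g∈X₀ g-moves k≢l k′≢l′ a′≢0 b′≢0

  X₀-order : ∀ w → weight w ≡ 2 → length X₀ ≡ (m C 2) * suc p ^ 2 * length (stabiliser X₀ w)
  X₀-order w w-weight = trans
    (G₀.orbit-stabiliser w (weightTwoVertices (suc p) m) (weightTwo-unique (suc p) m) into onto)
    (cong (_* length (stabiliser X₀ w)) (length-weightTwo (suc p) m))
    where
    into : ∀ {g} → g ∈ X₀ → act g w ∈ weightTwoVertices (suc p) m
    into g∈X₀ = ∈-weightTwo _ (trans (weight-invariant g∈X₀ w) w-weight)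
    onto : ∀ {t} → t ∈ weightTwoVertices (suc p) m → ∃ λ g → g ∈ X₀ × act g w ≡ t
    onto t∈ = X₀-transitive w _ w-weight (weightTwo-sound t∈)

  entries-transitive : ∀ {k l k′ l′} → k ≢ l → k′ ≢ l′ → ∃ λ g → g ∈ X₀ ×
    ((mapsEntry g k k′ × mapsEntry g l l′) ⊎ (mapsEntry g k l′ × mapsEntry g l k′))
  entries-transitive k≢l k′≢l′ = case pair-transitive k≢l k′≢l′ one≢0 one≢0 one≢0 one≢0 of λ where
    (g , g∈X₀ , inj₁ (k↦k′ , l↦l′)) → g , g∈X₀ , inj₁ (proj₁ k↦k′ , proj₁ l↦l′)
    (g , g∈X₀ , inj₂ (l↦k′ , k↦l′)) → g , g∈X₀ , inj₂ (proj₁ k↦l′ , proj₁ l↦k′)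

  -- If the
  -- element given by pair-transitive exchanges k and l, its square works.
  fixing-transitive : ∀ {k l} → k ≢ l → ∀ {a b} → a ≢ zero → b ≢ zero →
    ∃ λ g → g ∈ X₀ × mapsEntry g k k × mapsEntry g l l × letter g k a ≡ b
  fixing-transitive {k} {l} k≢l {a} {b} a≢0 b≢0
    = case pair-transitive {k} {a} {l} {a} {k} {b} {l} {a} k≢l k≢l a≢0 a≢0 b≢0 a≢0 of λ where
      (g , g∈X₀ , inj₁ ((k↦k , a↦b) , (l↦l , _))) → g , g∈X₀ , k↦k , l↦l , a↦b
      (g , g∈X₀ , inj₂ (l↦k , k↦l)) → square g∈X₀ l↦k k↦l
    where
    square : ∀ {g} → g ∈ X₀ → Sends g l a k b → Sends g k a l a →
      ∃ λ h → h ∈ X₀ × mapsEntry h k k × mapsEntry h l l × letter h k a ≡ b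
    square {g} g∈X₀ l↦k k↦l =
      compose g g , closed₀ g∈X₀ g∈X₀ , proj₁ a↦b ,
      mapsEntry-compose g g (proj₁ l↦k) (proj₁ k↦l) , proj₂ a↦b
      where
      a↦b : Sends (compose g g) k a k b
      a↦b = sends-compose g g k↦l l↦k

  ∈stab0ij⁺ : ∀ {i j g} → g ∈ X₀ → mapsEntry g i i → mapsEntry g j j → g ∈ stab0ij X i j
  ∈stab0ij⁺ {i} {j} g∈X₀ i↦i j↦j =
    ∈-filter⁺ (λ g → (perm g i ≟ i) ×-dec (perm g j ≟ j)) g∈X₀ (i↦i , j↦j)

  ∈stab0ij⁻ : ∀ {i j g} → g ∈ stab0ij X i j → g ∈ X₀ × mapsEntry g i i × mapsEntry g j j
  ∈stab0ij⁻ {i} {j} g∈ with ∈-filter⁻ (λ g → (perm g i ≟ i) ×-dec (perm g j ≟ j)) {xs = X₀} g∈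
  ... | g∈X₀ , i↦i , j↦j = g∈X₀ , i↦i , j↦j

  module EntryPair (i j : Fin m) (i≢j : i ≢ j) where

    Y : List (Elt m (suc (suc p)))
    Y = stab0ij X i j

    Pair : Set
    Pair = Fin (suc (suc p)) × Fin (suc (suc p))

    Crossing : Pair → Pair → Set
    Crossing (x₁ , x₂) (y₁ , y₂) = ∃ λ g → g ∈ X₀ × Sends g j x₂ i y₁ × Sends g i x₁ j y₂

    Swapper : Set
    Swapper = ∃ λ s → s ∈ X₀ × mapsEntry s i j × mapsEntry s j i

    transitive-on-i : TransOnQ× Y i
    transitive-on-i a b a≢0 b≢0 = case fixing-transitive i≢j a≢0 b≢0 of λ where
      (g , g∈X₀ , i↦i , j↦j , a↦b) → g , ∈stab0ij⁺ g∈X₀ i↦i j↦j , a↦b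

    transitive-on-j : TransOnQ× Y j
    transitive-on-j a b a≢0 b≢0 = case fixing-transitive (λ j≡i → i≢j (sym j≡i)) a≢0 b≢0 of λ where
      (g , g∈X₀ , j↦j , i↦i , a↦b) → g , ∈stab0ij⁺ g∈X₀ i↦i j↦j , a↦b

    reach : ∀ {x y} → NonzeroPair x → NonzeroPair y → InOrbit Y i j x y ⊎ Crossing x y
    reach (x₁≢0 , x₂≢0) (y₁≢0 , y₂≢0) = case pair-transitive i≢j i≢j x₁≢0 x₂≢0 y₁≢0 y₂≢0 of λ where
      (g , g∈X₀ , inj₁ ((i↦i , x₁↦y₁) , (j↦j , x₂↦y₂))) →
        inj₁ (g , ∈stab0ij⁺ g∈X₀ i↦i j↦j , cong₂ _,_ x₁↦y₁ x₂↦y₂)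
      (g , g∈X₀ , inj₂ crossed) → inj₂ (g , g∈X₀ , crossed)

    -- Part (2), first claim: the orbits of (1,1) and, if some τ ∈ X₀
    -- exchanges i and j, of the preimage (α, β) of (1,1) under τ cover all
    -- nonzero pairs: a crossing element g from (1,1) gives g ∘ τ ∈ Y.
    at-most-two-orbits : AtMostTwoOrbits Y i j
    at-most-two-orbits with any? (λ τ → (perm τ i ≟ j) ×-dec (perm τ j ≟ i)) X₀
    ... | no no-swapper = (one , one) , (one , one) , (one≢0 , one≢0) , (one≢0 , one≢0) , cover
      where
      cover : ∀ y → NonzeroPair y → InOrbit Y i j (one , one) y ⊎ InOrbit Y i j (one , one) y
      cover y y≢0 = case reach (one≢0 , one≢0) y≢0 of λ where
        (inj₁ in-orbit) → inj₁ in-orbit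
        (inj₂ (g , g∈X₀ , (j↦i , _) , (i↦j , _))) → ⊥-elim (no-swapper (lose g∈X₀ (j↦i , i↦j)))
    ... | yes swapper with find swapper
    ...   | τ , τ∈X₀ , (τj↦i , τi↦j)
      with fin-injective⇒surjective (letter τ j) (proj₂ (auts₀ τ∈X₀) j) one
         | fin-injective⇒surjective (letter τ i) (proj₂ (auts₀ τ∈X₀) i) one
    ...     | α , α↦1 | β , β↦1 = (one , one) , (α , β) , (one≢0 , one≢0) , (α≢0 , β≢0) , cover
      where
      α≢0 : α ≢ zero
      α≢0 refl = one≢0 (trans (sym α↦1) (letter-zero τ∈X₀ j))
      β≢0 : β ≢ zero
      β≢0 refl = one≢0 (trans (sym β↦1) (letter-zero τ∈X₀ i))
      through-τ : ∀ {g y₁ y₂} → g ∈ X₀ → Sends g j one i y₁ → Sends g i one j y₂ →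
        InOrbit Y i j (α , β) (y₁ , y₂)
      through-τ {g} g∈X₀ j↦i i↦j =
        compose g τ , ∈stab0ij⁺ (closed₀ g∈X₀ τ∈X₀) (proj₁ α↦y₁) (proj₁ β↦y₂) ,
        cong₂ _,_ (proj₂ α↦y₁) (proj₂ β↦y₂)
        where
        α↦y₁ = sends-compose g τ (τi↦j , α↦1) j↦i
        β↦y₂ = sends-compose g τ (τj↦i , β↦1) i↦j
      cover : ∀ y → NonzeroPair y → InOrbit Y i j (one , one) y ⊎ InOrbit Y i j (α , β) y
      cover y y≢0 = case reach (one≢0 , one≢0) y≢0 of λ where
        (inj₁ in-orbit) → inj₁ in-orbit
        (inj₂ (g , g∈X₀ , j↦i , i↦j)) → inj₂ (through-τ g∈X₀ j↦i i↦j)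

    -- the Y-orbit of x, listed as in the definition of orbitSize (so that
    -- orbitSize Y i j x is its length), and membership in it
    reached? : ∀ x y → Dec (Any (λ g → imgPair g i j x ≡ y) Y)
    reached? x y = any? (λ g → ≡-dec-× _≟_ _≟_ (imgPair g i j x) y) Y

    orbit : Pair → List Pair
    orbit x = filter (reached? x) (cartesianProduct (allFin (suc (suc p))) (allFin (suc (suc p))))

    orbit⁺ : ∀ {x y} → InOrbit Y i j x y → y ∈ orbit x
    orbit⁺ {x} (g , g∈Y , gx≡y) =
      ∈-filter⁺ (reached? x) (∈-cartesianProduct⁺ (∈-allFin _) (∈-allFin _)) (lose g∈Y gx≡y)

    orbit⁻ : ∀ {x y} → y ∈ orbit x → InOrbit Y i j x y
    orbit⁻ {x} y∈ = find (proj₂ (∈-filter⁻ (reached? x) {xs = cartesianProduct (allFin _) (allFin _)} y∈))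

    orbit-unique : ∀ x → Unique (orbit x)
    orbit-unique x = filter⁺ (reached? x) (cartesianProduct⁺ (allFin⁺ _) (allFin⁺ _))

    cross : Elt m (suc (suc p)) → Pair → Pair
    cross c (z₁ , z₂) = letter c i z₂ , letter c j z₁

    cross-injective : ∀ {c} → c ∈ X₀ → ∀ {z z′} → cross c z ≡ cross c z′ → z ≡ z′
    cross-injective c∈X₀ same = cong₂ _,_ (proj₂ (auts₀ c∈X₀) j (cong proj₂ same))
                                          (proj₂ (auts₀ c∈X₀) i (cong proj₁ same))

    -- Conjugation by an element c crossing x to y (with inverse d) carries the
    -- Y-orbit of x into that of y: if k ∈ Y sends x to z then c ∘ k ∘ d ∈ Y
    -- sends y to cross c z.
    conjugate : ∀ {c d x₁ x₂ y₁ y₂ z} → c ∈ X₀ → d ∈ X₀ → compose c d ≡ idE → compose d c ≡ idE →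
      Sends c j x₂ i y₁ → Sends c i x₁ j y₂ →
      InOrbit Y i j (x₁ , x₂) z → InOrbit Y i j (y₁ , y₂) (cross c z)
    conjugate {c} {d} c∈X₀ d∈X₀ cd≡id dc≡id x₂↦y₁ x₁↦y₂ (k , k∈Y , kx≡z) =
      compose c (compose k d) ,
      ∈stab0ij⁺ (closed₀ c∈X₀ (closed₀ k∈X₀ d∈X₀)) (proj₁ y₁↦) (proj₁ y₂↦) ,
      cong₂ _,_ (proj₂ y₁↦) (proj₂ y₂↦)
      where
      k∈X₀ = proj₁ (∈stab0ij⁻ k∈Y)
      i↦i = proj₁ (proj₂ (∈stab0ij⁻ k∈Y))
      j↦j = proj₂ (proj₂ (∈stab0ij⁻ k∈Y))
      y₁↦ = sends-compose c (compose k d)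
              (sends-compose k d (sends-inverse c d cd≡id dc≡id x₂↦y₁) (j↦j , cong proj₂ kx≡z))
              (proj₁ x₂↦y₁ , refl)
      y₂↦ = sends-compose c (compose k d)
              (sends-compose k d (sends-inverse c d cd≡id dc≡id x₁↦y₂) (i↦i , cong proj₁ kx≡z))
              (proj₁ x₁↦y₂ , refl)

    crossed-orbit-≤ : ∀ {c d x₁ x₂ y₁ y₂} → c ∈ X₀ → d ∈ X₀ →
      compose c d ≡ idE → compose d c ≡ idE →
      Sends c j x₂ i y₁ → Sends c i x₁ j y₂ → orbitSize Y i j (x₁ , x₂) ≤ orbitSize Y i j (y₁ , y₂)
    crossed-orbit-≤ {c} c∈X₀ d∈X₀ cd≡id dc≡id x₂↦y₁ x₁↦y₂ =
      injection⇒length≤ (cross c) (orbit-unique _)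
        (λ _ _ → cross-injective c∈X₀)
        (λ z∈ → orbit⁺ (conjugate c∈X₀ d∈X₀ cd≡id dc≡id x₂↦y₁ x₁↦y₂ (orbit⁻ z∈)))

    -- and the inverse of a crossing element crosses back
    crossed-orbit-≡ : ∀ {x y} → Crossing x y → orbitSize Y i j x ≡ orbitSize Y i j y
    crossed-orbit-≡ (c , c∈X₀ , x₂↦y₁ , x₁↦y₂) = case inverse₀ c∈X₀ of λ where
      (d , d∈X₀ , cd≡id , dc≡id) → ≤-antisym
        (crossed-orbit-≤ {c} {d} c∈X₀ d∈X₀ cd≡id dc≡id x₂↦y₁ x₁↦y₂)
        (crossed-orbit-≤ {d} {c} d∈X₀ c∈X₀ dc≡id cd≡id
          (sends-inverse c d cd≡id dc≡id x₁↦y₂) (sends-inverse c d cd≡id dc≡id x₂↦y₁))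

    -- With an element s exchanging i and j, X₀ maps every pair of distinct
    -- entries onto (i, j) in order, and (i, j) onto every such pair:
    -- compose with s when entries-transitive exchanges the two entries.
    onto-ij : Swapper → ∀ {k l} → k ≢ l → ∃ λ g → g ∈ X₀ × mapsEntry g k i × mapsEntry g l j
    onto-ij (s , s∈X₀ , i↦j , j↦i) k≢l = case entries-transitive k≢l i≢j of λ where
      (g , g∈X₀ , inj₁ (k↦i , l↦j)) → g , g∈X₀ , k↦i , l↦j
      (g , g∈X₀ , inj₂ (k↦j , l↦i)) →
        compose s g , closed₀ s∈X₀ g∈X₀ , mapsEntry-compose s g k↦j j↦i , mapsEntry-compose s g l↦i i↦j

    from-ij : Swapper → ∀ {k l} → k ≢ l → ∃ λ g → g ∈ X₀ × mapsEntry g i k × mapsEntry g j l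
    from-ij (s , s∈X₀ , i↦j , j↦i) k≢l = case entries-transitive i≢j k≢l of λ where
      (g , g∈X₀ , inj₁ (i↦k , j↦l)) → g , g∈X₀ , i↦k , j↦l
      (g , g∈X₀ , inj₂ (i↦l , j↦k)) →
        compose g s , closed₀ g∈X₀ s∈X₀ , mapsEntry-compose g s i↦j j↦k , mapsEntry-compose g s j↦i i↦l

    two-transitive : Swapper → TwoTransitiveOnM X₀
    two-transitive s i₁ j₁ i₂ j₂ i₁≢j₁ i₂≢j₂ = case onto-ij s i₁≢j₁ , from-ij s i₂≢j₂ of λ where
      ((g , g∈X₀ , i₁↦i , j₁↦j) , (h , h∈X₀ , i↦i₂ , j↦j₂)) →
        compose h g , closed₀ h∈X₀ g∈X₀ ,
        mapsEntry-compose h g i₁↦i i↦i₂ , mapsEntry-compose h g j₁↦j j↦j₂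

    -- Part (2), second claim: two nonzero pairs in different Y-orbits are
    -- related by a crossing element, which equalises the orbit sizes and
    -- exchanges i and j, making X₀ 2-transitive on entries.
    two-orbits : ∀ x y → NonzeroPair x → NonzeroPair y → ¬ InOrbit Y i j x y →
      (orbitSize Y i j x ≡ orbitSize Y i j y) × TwoTransitiveOnM X₀
    two-orbits x y x≢0 y≢0 not-in-orbit = case reach x≢0 y≢0 of λ where
      (inj₁ in-orbit) → ⊥-elim (not-in-orbit in-orbit)
      (inj₂ (c , c∈X₀ , j↦i , i↦j)) →
        crossed-orbit-≡ (c , c∈X₀ , j↦i , i↦j) , two-transitive (c , c∈X₀ , proj₁ i↦j , proj₁ j↦i)

    -- Part (3): the pair vertex (1 at i, 1 at j) has weight two, so
    -- (m choose 2)(q−1)² divides |X₀| by orbit–stabiliser, and |X₀| divides |X|.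
    order-divides : (m C 2) * suc p ^ 2 ∣ length X₀ × (m C 2) * suc p ^ 2 ∣ length X
    order-divides = divides-X₀ , ∣-trans divides-X₀ (GX.stabiliser∣group 𝟎)
      where
      w = pairVertex i one j one
      divides-X₀ : (m C 2) * suc p ^ 2 ∣ length X₀
      divides-X₀ = divides (length (stabiliser X₀ w))
        (trans (X₀-order w (weight-pairVertex i j one one i≢j one≢0 one≢0)) (*-comm ((m C 2) * suc p ^ 2) _))

choose2-positive : ∀ {m} (i j : Fin m) → i ≢ j → 0 < m C 2
choose2-positive {suc zero}    zero zero i≢j = ⊥-elim (i≢j refl)
choose2-positive {suc (suc m)} _    _    _   =
  subst (0 <_) (trans (cong (_+ suc m C 2) (sym (nC1≡n (suc m)))) (nCk+nC[k+1]≡[n+1]C[k+1] (suc m) 1)) (s≤s z≤n)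

square-divisor-is-one : ∀ {c} n → 0 < c → c * n ^ 2 ∣ c → n ≡ 1
square-divisor-is-one {c} n 0<c c*n²∣c =
  m*n≡1⇒m≡1 n (n * 1)
    (∣1⇒≡1 (*-cancelˡ-∣ c {{>-nonZero 0<c}} (subst (c * n ^ 2 ∣_) (sym (*-identityʳ c)) c*n²∣c)))

single-vertex : ∀ {m} (u v : Vec (Fin 1) m) → u ≡ v
single-vertex []         []         = refl
single-vertex (zero ∷ u) (zero ∷ v) = cong (zero ∷_) (single-vertex u v)

-- Lemma 2.3.  For q = 1 there are no two distinct codewords, contradicting
-- the minimum distance; otherwise parts (1)–(3) are proved above for the
-- pair i, j, and (4) follows from (3): (m choose 2)(q−1)² divides
-- |X₀| = (m choose 2) > 0, forcing q − 1 = 1.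
lemma2p3 : (m p : ℕ) (X : List (Elt m (suc p))) (𝒞 : Code m (suc p)) (δ : ℕ) →
    IsSubgroup X → X ≤AutC 𝒞 → TwoNT X 𝒞 →
    MinDist 𝒞 δ → 5 ≤ δ → 𝒞 (zeroV m p) ≡ true →
    (i j : Fin m) → i ≢ j →
    (TransOnQ× (stab0ij X i j) i × TransOnQ× (stab0ij X i j) j)
    × (AtMostTwoOrbits (stab0ij X i j) i j
       × (∀ x y → NonzeroPair x → NonzeroPair y → ¬ InOrbit (stab0ij X i j) i j x y →
            (orbitSize (stab0ij X i j) i j x ≡ orbitSize (stab0ij X i j) i j y)
            × TwoTransitiveOnM (stab0 X)))
    × ((m C 2) * (suc p ∸ 1) ^ 2 ∣ length (stab0 X)
       × (m C 2) * (suc p ∸ 1) ^ 2 ∣ length X)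
    × (length (stab0 X) ≡ m C 2 → suc p ≡ 2)
lemma2p3 m zero X 𝒞 δ _ _ _ ((c , c′ , _ , _ , c≢c′ , _) , _) _ _ _ _ _ =
  ⊥-elim (c≢c′ (single-vertex c c′))
lemma2p3 m (suc p) X 𝒞 δ subgroup X≤AutC 2-nt minDist 5≤δ 𝟎∈C i j i≢j =
  (transitive-on-i , transitive-on-j) , (at-most-two-orbits , two-orbits) , order-divides , binary
  where
  open NeighbourTransitiveCode subgroup X≤AutC 2-nt minDist 5≤δ 𝟎∈C
  open EntryPair i j i≢j
  binary : length X₀ ≡ m C 2 → suc (suc p) ≡ 2
  binary |X₀|≡m₂ = cong suc (square-divisor-is-one (suc p) (choose2-positive i j i≢j)
                               (subst ((m C 2) * suc p ^ 2 ∣_) |X₀|≡m₂ (proj₁ order-divides)))
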